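{- Let $B,D$ be nonempty subsets of $\mathbb{Z}_m$. The multiset $B-D=\{x-y\bmod m:(x,y)\in B\times D\}$ is symmetric (each $w\in\mathbb{Z}_m$ occurs with the same multiplicity as $-w$) if and only if $B^c$ and $D^c$ are amicable, i.e. $B^c(D^c)^\top$ is a symmetric matrix.
   Context: For $S\subseteq\mathbb{Z}_m$ with characteristic function $\chi_S$, $S^c$ is the $\mathbb{Z}_m$-indexed matrix whose $(i,j)$ entry is $1-2\chi_S(j-i)$. -}

module Defs where

open import Data.Nat as ℕ using (ℕ; zero; suc; NonZero)
open import Data.Nat.DivMod using (_mod_)
open import Data.Fin using (Fin; toℕ; _≟_)
open import Relation.Nullary using (yes; no)
open import Relation.Binary.PropositionalEquality using (_≡_)
open import Data.Fin using () renaming (zero to zeroF; suc to sucF)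
open import Data.Fin.Subset using (Subset)
open import Data.Bool using (Bool; true; false)
open import Data.Vec using (lookup)
open import Data.Integer as ℤ using (ℤ; +_)

Σℤ : ∀ n → (Fin n → ℤ) → ℤ
Σℤ zero    f = + 0
Σℤ (suc n) f = f zeroF ℤ.+ Σℤ n (λ i → f (sucF i))

Σℕ : ∀ n → (Fin n → ℕ) → ℕ
Σℕ zero    f = 0
Σℕ (suc n) f = f zeroF ℕ.+ Σℕ n (λ i → f (sucF i))

_⊖ₘ_ : ∀ {m} .{{_ : NonZero m}} → Fin m → Fin m → Fin m
_⊖ₘ_ {m} x y = (toℕ x ℕ.+ (m ℕ.∸ toℕ y)) mod m

negₘ : ∀ {m} .{{_ : NonZero m}} → Fin m → Fin m
negₘ {m} x = (m ℕ.∸ toℕ x) mod m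

χ : ∀ {m} → Subset m → Fin m → ℕ
χ S x with lookup S x
... | true  = 1
... | false = 0

δ : ∀ {m} → Fin m → Fin m → ℕ
δ x y with x ≟ y
... | yes _ = 1
... | no _  = 0

mult : ∀ {m} .{{_ : NonZero m}} → Subset m → Subset m → Fin m → ℕ
mult {m} B D w = Σℕ m (λ x → Σℕ m (λ y → χ B x ℕ.* χ D y ℕ.* δ (x ⊖ₘ y) w))

DiffSymmetric : ∀ {m} .{{_ : NonZero m}} → Subset m → Subset m → Set
DiffSymmetric {m} B D = ∀ (w : Fin m) → mult B D w ≡ mult B D (negₘ w)

_ᶜ : ∀ {m} .{{_ : NonZero m}} → Subset m → Fin m → Fin m → ℤ
(S ᶜ) i j = + 1 ℤ.- + (2 ℕ.* χ S (j ⊖ₘ i))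

_·ᵀ_ : ∀ {m} → (Fin m → Fin m → ℤ) → (Fin m → Fin m → ℤ) → Fin m → Fin m → ℤ
_·ᵀ_ {m} M N i j = Σℤ m (λ k → M i k ℤ.* N j k)

SymmetricMatrix : ∀ {m} → (Fin m → Fin m → ℤ) → Set
SymmetricMatrix {m} M = ∀ (i j : Fin m) → M i j ≡ M j i

Amicable : ∀ {m} → (Fin m → Fin m → ℤ) → (Fin m → Fin m → ℤ) → Set
Amicable M N = SymmetricMatrix (M ·ᵀ N)

-- Write a k = χ B (k - i) and b k = χ D (k - j). The (i, j) entry of Bᶜ (Dᶜ)ᵀ is
-- Σₖ (1 - 2 a k)(1 - 2 b k) = m - 2 Σₖ a k - 2 Σₖ b k + 4 Σₖ a k b k. Translating k
-- by i (resp. j) turns Σₖ a k into |B| and Σₖ b k into |D|, and turns Σₖ a k b k into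
-- the number of pairs (x, y) ∈ B × D with x - y = j - i, the multiplicity of j - i in B - D.
-- So the (i, j) and (j, i) entries agree exactly when j - i and i - j occur equally often.
module Submission where

open import Defs
open import Data.Nat using (ℕ; NonZero)
open import Data.Fin.Subset using (Subset; Nonempty)
open import Data.Product using (_×_)

open import Algebra.Bundles using (AbelianGroup; CommutativeMonoid)
import Algebra.Properties.CommutativeMonoid.Sum as CommutativeMonoidSum
import Algebra.Properties.Semiring.Sum as SemiringSum
open import Data.Fin using (Fin; zero; suc; toℕ; _≟_)
open import Data.Fin.Permutation using (permutation)
open import Data.Fin.Properties using (toℕ-fromℕ<; toℕ-injective; toℕ<n; toℕ≤n; suc-injective)
open import Data.Integer as ℤ using (ℤ)
import Data.Integer.Properties as ℤ
open import Data.Integer.Tactic.RingSolver using (solve-∀)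
open import Data.Nat as ℕ using (zero; suc; _+_; _*_; _∸_; _%_)
open import Data.Nat.DivMod using (_mod_; m%n%n≡m%n; %-distribˡ-+; [m+n]%n≡m%n; m<n⇒m%n≡m; m%n<n)
import Data.Nat.Properties as ℕ
open import Data.Product using (_,_)
open import Function.Base using (_∘_)
open import Function.Bundles using (_⇔_; mk⇔; Equivalence)
open import Level using (0ℓ)
open import Relation.Binary.Bundles using (Setoid)
open import Relation.Binary.PropositionalEquality
open import Relation.Binary.Structures using (IsEquivalence)
import Relation.Binary.Reasoning.Setoid as SetoidReasoning
open import Relation.Nullary using (yes; no; contradiction)

open import Algebra.Properties.CommutativeSemigroup ℤ.+-commutativeSemigroup using (interchange)
open import Algebra.Properties.Group (AbelianGroup.group ℤ.+-0-abelianGroup) using (∙-cancelʳ)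
open SemiringSum ℕ.+-*-semiring using (sum; sum-syntax; sum-cong-≗; sum-replicate-zero; ∑-distrib-+; *-distribˡ-sum)

Σℕ≡sum : ∀ k (f : Fin k → ℕ) → Σℕ k f ≡ sum f
Σℕ≡sum zero    f = refl
Σℕ≡sum (suc k) f = cong (f zero +_) (Σℕ≡sum k (f ∘ suc))

∑[i<k]1≡k : ∀ k → ∑[ i < k ] 1 ≡ k
∑[i<k]1≡k zero    = refl
∑[i<k]1≡k (suc k) = cong suc (∑[i<k]1≡k k)

δ-cong : ∀ {k l} {x y : Fin k} {u v : Fin l} → x ≡ y ⇔ u ≡ v → δ x y ≡ δ u v
δ-cong {x = x} {y} {u} {v} x≡y⇔u≡v with x ≟ y | u ≟ v
... | yes _   | yes _   = refl
... | no _    | no _    = refl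
... | yes x≡y | no u≢v  = contradiction (Equivalence.to x≡y⇔u≡v x≡y) u≢v
... | no x≢y  | yes u≡v = contradiction (Equivalence.from x≡y⇔u≡v u≡v) x≢y

∑-δ : ∀ {k} (f : Fin k → ℕ) t → ∑[ y < k ] (f y * δ y t) ≡ f t
∑-δ {suc k} f zero = begin
  f zero * 1 + ∑[ y < k ] (f (suc y) * 0) ≡⟨ cong₂ _+_ (ℕ.*-identityʳ (f zero)) (sum-cong-≗ (ℕ.*-zeroʳ ∘ f ∘ suc)) ⟩
  f zero + ∑[ y < k ] 0                   ≡⟨ cong (f zero +_) (sum-replicate-zero k) ⟩
  f zero + 0                              ≡⟨ ℕ.+-identityʳ (f zero) ⟩
  f zero                                  ∎
  where open ≡-Reasoning
∑-δ {suc k} f (suc t) = begin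
  f zero * 0 + ∑[ y < k ] (f (suc y) * δ (suc y) (suc t)) ≡⟨ cong₂ _+_ (ℕ.*-zeroʳ (f zero)) (sum-cong-≗ δ-suc) ⟩
  ∑[ y < k ] (f (suc y) * δ y t)                          ≡⟨ ∑-δ (f ∘ suc) t ⟩
  f (suc t)                                               ∎
  where
  open ≡-Reasoning
  δ-suc : ∀ y → f (suc y) * δ (suc y) (suc t) ≡ f (suc y) * δ y t
  δ-suc y = cong (f (suc y) *_) (δ-cong (mk⇔ suc-injective (cong suc)))

Σℤ-+-∑ : ∀ k (f : Fin k → ℤ) (g h : Fin k → ℕ) → (∀ x → f x ℤ.+ ℤ.+ g x ≡ ℤ.+ h x) →
         Σℤ k f ℤ.+ ℤ.+ sum g ≡ ℤ.+ sum h
Σℤ-+-∑ zero    f g h eq = refl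
Σℤ-+-∑ (suc k) f g h eq = begin
  (f zero ℤ.+ Σℤ k (f ∘ suc)) ℤ.+ ℤ.+ (g zero + sum (g ∘ suc))
    ≡⟨ cong (ℤ._+_ (f zero ℤ.+ Σℤ k (f ∘ suc))) (ℤ.pos-+ (g zero) _) ⟩
  (f zero ℤ.+ Σℤ k (f ∘ suc)) ℤ.+ (ℤ.+ g zero ℤ.+ ℤ.+ sum (g ∘ suc))
    ≡⟨ interchange (f zero) _ _ _ ⟩
  (f zero ℤ.+ ℤ.+ g zero) ℤ.+ (Σℤ k (f ∘ suc) ℤ.+ ℤ.+ sum (g ∘ suc))
    ≡⟨ cong₂ ℤ._+_ (eq zero) (Σℤ-+-∑ k (f ∘ suc) (g ∘ suc) (h ∘ suc) (eq ∘ suc)) ⟩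
  ℤ.+ h zero ℤ.+ ℤ.+ sum (h ∘ suc)
    ≡⟨ ℤ.pos-+ (h zero) _ ⟨
  ℤ.+ (h zero + sum (h ∘ suc))
    ∎
  where open ≡-Reasoning

-- The negative terms of (1 - 2a)(1 - 2b) = 1 - 2a - 2b + 4ab are moved to the left,
-- so that both the added term and the right-hand side are natural numbers.
±1-product : ∀ a b → (ℤ.+ 1 ℤ.- ℤ.+ (2 * a)) ℤ.* (ℤ.+ 1 ℤ.- ℤ.+ (2 * b)) ℤ.+ ℤ.+ (2 * a + 2 * b)
                   ≡ ℤ.+ (1 + 4 * (a * b))
±1-product a b = begin
  (ℤ.+ 1 ℤ.- ℤ.+ (2 * a)) ℤ.* (ℤ.+ 1 ℤ.- ℤ.+ (2 * b)) ℤ.+ ℤ.+ (2 * a + 2 * b)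
    ≡⟨ cong₂ ℤ._+_ (cong₂ (λ u v → (ℤ.+ 1 ℤ.- u) ℤ.* (ℤ.+ 1 ℤ.- v)) (ℤ.pos-* 2 a) (ℤ.pos-* 2 b))
                   (trans (ℤ.pos-+ (2 * a) (2 * b)) (cong₂ ℤ._+_ (ℤ.pos-* 2 a) (ℤ.pos-* 2 b))) ⟩
  (ℤ.+ 1 ℤ.- ℤ.+ 2 ℤ.* x) ℤ.* (ℤ.+ 1 ℤ.- ℤ.+ 2 ℤ.* y) ℤ.+ (ℤ.+ 2 ℤ.* x ℤ.+ ℤ.+ 2 ℤ.* y)
    ≡⟨ polynomial x y ⟩
  ℤ.+ 1 ℤ.+ ℤ.+ 4 ℤ.* (x ℤ.* y)
    ≡⟨ trans (ℤ.pos-+ 1 (4 * (a * b))) (cong (ℤ._+_ (ℤ.+ 1)) (trans (ℤ.pos-* 4 (a * b)) (cong (ℤ.+ 4 ℤ.*_) (ℤ.pos-* a b)))) ⟨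
  ℤ.+ (1 + 4 * (a * b))
    ∎
  where
  open ≡-Reasoning
  x y : ℤ
  x = ℤ.+ a
  y = ℤ.+ b
  polynomial : ∀ x y → (ℤ.+ 1 ℤ.- ℤ.+ 2 ℤ.* x) ℤ.* (ℤ.+ 1 ℤ.- ℤ.+ 2 ℤ.* y) ℤ.+ (ℤ.+ 2 ℤ.* x ℤ.+ ℤ.+ 2 ℤ.* y)
                     ≡ ℤ.+ 1 ℤ.+ ℤ.+ 4 ℤ.* (x ℤ.* y)
  polynomial = solve-∀

module _ {n : ℕ} where

  private
    m : ℕ
    m = suc n

  -- A record rather than a synonym for a % m ≡ b % m, so that a and b stay inferable.
  infix 4 _≋_
  record _≋_ (a b : ℕ) : Set where
    constructor mk≋
    field %-≡ : a % m ≡ b % m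

  ≋-isEquivalence : IsEquivalence _≋_
  ≋-isEquivalence = record
    { refl  = mk≋ refl
    ; sym   = λ (mk≋ p) → mk≋ (sym p)
    ; trans = λ (mk≋ p) (mk≋ q) → mk≋ (trans p q)
    }

  open IsEquivalence ≋-isEquivalence public
    using () renaming (refl to ≋-refl; sym to ≋-sym; trans to ≋-trans; reflexive to ≋-reflexive)

  ≋-setoid : Setoid 0ℓ 0ℓ
  ≋-setoid = record { isEquivalence = ≋-isEquivalence }

  module ≋-Reasoning = SetoidReasoning ≋-setoid

  _⊕ₘ_ : Fin m → Fin m → Fin m
  x ⊕ₘ y = (toℕ x + toℕ y) mod m

  toℕ-mod : ∀ a → toℕ (a mod m) ≋ a
  toℕ-mod a = mk≋ (trans (cong (_% m) (toℕ-fromℕ< (m%n<n a m))) (m%n%n≡m%n a m))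

  +-cong-≋ : ∀ {a b c d} → a ≋ b → c ≋ d → a + c ≋ b + d
  +-cong-≋ {a} {b} {c} {d} (mk≋ a≋b) (mk≋ c≋d) = mk≋ (begin
    (a + c) % m           ≡⟨ %-distribˡ-+ a c m ⟩
    (a % m + c % m) % m   ≡⟨ cong₂ (λ u v → (u + v) % m) a≋b c≋d ⟩
    (b % m + d % m) % m   ≡⟨ %-distribˡ-+ b d m ⟨
    (b + d) % m           ∎)
    where open ≡-Reasoning

  +m≋ : ∀ a → a + m ≋ a
  +m≋ a = mk≋ ([m+n]%n≡m%n a m)

  ≋⇒≡ : ∀ {x y : Fin m} → toℕ x ≋ toℕ y → x ≡ y
  ≋⇒≡ {x} {y} (mk≋ x≋y) = toℕ-injective (begin
    toℕ x       ≡⟨ m<n⇒m%n≡m (toℕ<n x) ⟨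
    toℕ x % m   ≡⟨ x≋y ⟩
    toℕ y % m   ≡⟨ m<n⇒m%n≡m (toℕ<n y) ⟩
    toℕ y       ∎)
    where open ≡-Reasoning

  +-cancelʳ-≋ : ∀ {a b} (y : Fin m) → a + toℕ y ≋ b + toℕ y → a ≋ b
  +-cancelʳ-≋ {a} {b} y eq = begin
    a                                ≈⟨ +m≋ a ⟨
    a + m                            ≡⟨ cong (a +_) y+[m∸y]≡m ⟨
    a + (toℕ y + (m ∸ toℕ y))        ≡⟨ ℕ.+-assoc a _ _ ⟨
    a + toℕ y + (m ∸ toℕ y)          ≈⟨ +-cong-≋ eq ≋-refl ⟩
    b + toℕ y + (m ∸ toℕ y)          ≡⟨ ℕ.+-assoc b _ _ ⟩
    b + (toℕ y + (m ∸ toℕ y))        ≡⟨ cong (b +_) y+[m∸y]≡m ⟩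
    b + m                            ≈⟨ +m≋ b ⟩
    b                                ∎
    where
    open ≋-Reasoning
    y+[m∸y]≡m : toℕ y + (m ∸ toℕ y) ≡ m
    y+[m∸y]≡m = ℕ.m+[n∸m]≡n (toℕ≤n y)

  ⊖ₘ-+-≋ : ∀ (x y : Fin m) → toℕ (x ⊖ₘ y) + toℕ y ≋ toℕ x
  ⊖ₘ-+-≋ x y = begin
    toℕ (x ⊖ₘ y) + toℕ y             ≈⟨ +-cong-≋ (toℕ-mod (toℕ x + (m ∸ toℕ y))) ≋-refl ⟩
    toℕ x + (m ∸ toℕ y) + toℕ y      ≡⟨ ℕ.+-assoc (toℕ x) _ _ ⟩
    toℕ x + ((m ∸ toℕ y) + toℕ y)    ≡⟨ cong (toℕ x +_) (ℕ.m∸n+n≡m (toℕ≤n y)) ⟩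
    toℕ x + m                        ≈⟨ +m≋ (toℕ x) ⟩
    toℕ x                            ∎
    where open ≋-Reasoning

  ⊖ₘ-unique : ∀ {x y z : Fin m} → toℕ z + toℕ y ≋ toℕ x → z ≡ x ⊖ₘ y
  ⊖ₘ-unique {x} {y} eq = ≋⇒≡ (+-cancelʳ-≋ y (≋-trans eq (≋-sym (⊖ₘ-+-≋ x y))))

  [x⊕i]⊖i≡x : ∀ (x i : Fin m) → (x ⊕ₘ i) ⊖ₘ i ≡ x
  [x⊕i]⊖i≡x x i = sym (⊖ₘ-unique (≋-sym (toℕ-mod (toℕ x + toℕ i))))

  [k⊖i]⊕i≡k : ∀ (k i : Fin m) → (k ⊖ₘ i) ⊕ₘ i ≡ k
  [k⊖i]⊕i≡k k i = ≋⇒≡ (≋-trans (toℕ-mod (toℕ (k ⊖ₘ i) + toℕ i)) (⊖ₘ-+-≋ k i))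

  [k⊖i]⊖[j⊖i]≡k⊖j : ∀ (i j k : Fin m) → (k ⊖ₘ i) ⊖ₘ (j ⊖ₘ i) ≡ k ⊖ₘ j
  [k⊖i]⊖[j⊖i]≡k⊖j i j k = sym (⊖ₘ-unique (+-cancelʳ-≋ i (begin
    toℕ (k ⊖ₘ j) + toℕ (j ⊖ₘ i) + toℕ i     ≡⟨ ℕ.+-assoc (toℕ (k ⊖ₘ j)) _ _ ⟩
    toℕ (k ⊖ₘ j) + (toℕ (j ⊖ₘ i) + toℕ i)   ≈⟨ +-cong-≋ ≋-refl (⊖ₘ-+-≋ j i) ⟩
    toℕ (k ⊖ₘ j) + toℕ j                     ≈⟨ ⊖ₘ-+-≋ k j ⟩
    toℕ k                                    ≈⟨ ⊖ₘ-+-≋ k i ⟨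
    toℕ (k ⊖ₘ i) + toℕ i                     ∎)))
    where open ≋-Reasoning

  x⊖[x⊖w]≡w : ∀ (x w : Fin m) → x ⊖ₘ (x ⊖ₘ w) ≡ w
  x⊖[x⊖w]≡w x w = sym (⊖ₘ-unique (≋-trans (≋-reflexive (ℕ.+-comm (toℕ w) _)) (⊖ₘ-+-≋ x w)))

  x⊖x≡0 : ∀ (x : Fin m) → x ⊖ₘ x ≡ zero
  x⊖x≡0 x = sym (⊖ₘ-unique {x} {x} ≋-refl)

  x⊖0≡x : ∀ (x : Fin m) → x ⊖ₘ zero ≡ x
  x⊖0≡x x = sym (⊖ₘ-unique (≋-reflexive (ℕ.+-identityʳ (toℕ x))))

  -- negₘ y and zero ⊖ₘ y are the same term, as 0 + a reduces to a.
  negₘ[j⊖i]≡i⊖j : ∀ (i j : Fin m) → negₘ (j ⊖ₘ i) ≡ i ⊖ₘ j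
  negₘ[j⊖i]≡i⊖j i j = trans (cong (_⊖ₘ (j ⊖ₘ i)) (sym (x⊖x≡0 i))) ([k⊖i]⊖[j⊖i]≡k⊖j i j i)

  module _ {c ℓ} (M : CommutativeMonoid c ℓ) where
    open CommutativeMonoid M using (Carrier; _≈_)
    private module S = CommutativeMonoidSum M

    sum-shift : ∀ (f : Fin m → Carrier) i → S.sum f ≈ S.sum (λ k → f (k ⊖ₘ i))
    sum-shift f i = S.sum-permute f (permutation (_⊖ₘ i) (_⊕ₘ i) (λ x → [x⊕i]⊖i≡x x i) (λ k → [k⊖i]⊕i≡k k i))

  ℕ-sum-shift : ∀ (f : Fin m → ℕ) i → sum f ≡ sum (λ k → f (k ⊖ₘ i))
  ℕ-sum-shift = sum-shift ℕ.+-0-commutativeMonoid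

  x⊖y≡w⇔y≡x⊖w : ∀ (x y w : Fin m) → x ⊖ₘ y ≡ w ⇔ y ≡ x ⊖ₘ w
  x⊖y≡w⇔y≡x⊖w x y w = mk⇔
    (λ x⊖y≡w → trans (sym (x⊖[x⊖w]≡w x y)) (cong (x ⊖ₘ_) x⊖y≡w))
    (λ y≡x⊖w → trans (cong (x ⊖ₘ_) y≡x⊖w) (x⊖[x⊖w]≡w x w))

  correlation : Subset m → Subset m → Fin m → ℕ
  correlation B D w = ∑[ x < m ] (χ B x * χ D (x ⊖ₘ w))

  mult≡correlation : ∀ B D w → mult B D w ≡ correlation B D w
  mult≡correlation B D w = trans (Σℕ≡sum m (λ x → Σℕ m (λ y → χ B x * χ D y * δ (x ⊖ₘ y) w))) (sum-cong-≗ inner)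
    where
    open ≡-Reasoning
    inner : ∀ x → Σℕ m (λ y → χ B x * χ D y * δ (x ⊖ₘ y) w) ≡ χ B x * χ D (x ⊖ₘ w)
    inner x = begin
      Σℕ m (λ y → χ B x * χ D y * δ (x ⊖ₘ y) w)      ≡⟨ Σℕ≡sum m (λ y → χ B x * χ D y * δ (x ⊖ₘ y) w) ⟩
      ∑[ y < m ] (χ B x * χ D y * δ (x ⊖ₘ y) w)      ≡⟨ sum-cong-≗ (λ y → trans (ℕ.*-assoc (χ B x) (χ D y) (δ (x ⊖ₘ y) w))
                                                          (cong (λ d → χ B x * (χ D y * d)) (δ-cong (x⊖y≡w⇔y≡x⊖w x y w)))) ⟩
      ∑[ y < m ] (χ B x * (χ D y * δ y (x ⊖ₘ w)))    ≡⟨ *-distribˡ-sum (χ B x) (λ y → χ D y * δ y (x ⊖ₘ w)) ⟨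
      χ B x * ∑[ y < m ] (χ D y * δ y (x ⊖ₘ w))      ≡⟨ cong (χ B x *_) (∑-δ (χ D) (x ⊖ₘ w)) ⟩
      χ B x * χ D (x ⊖ₘ w)                           ∎

  ∑-shifted-product≡correlation : ∀ B D (i j : Fin m) →
    ∑[ k < m ] (χ B (k ⊖ₘ i) * χ D (k ⊖ₘ j)) ≡ correlation B D (j ⊖ₘ i)
  ∑-shifted-product≡correlation B D i j = begin
    ∑[ k < m ] (χ B (k ⊖ₘ i) * χ D (k ⊖ₘ j))                ≡⟨ sum-cong-≗ (λ k → cong (λ v → χ B (k ⊖ₘ i) * χ D v)
                                                                 ([k⊖i]⊖[j⊖i]≡k⊖j i j k)) ⟨
    ∑[ k < m ] (χ B (k ⊖ₘ i) * χ D ((k ⊖ₘ i) ⊖ₘ (j ⊖ₘ i)))  ≡⟨ ℕ-sum-shift (λ x → χ B x * χ D (x ⊖ₘ (j ⊖ₘ i))) i ⟨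
    correlation B D (j ⊖ₘ i)                                ∎
    where open ≡-Reasoning

  ·ᵀ-entry : ∀ B D (i j : Fin m) →
    ((B ᶜ) ·ᵀ (D ᶜ)) i j ℤ.+ ℤ.+ (2 * ∑[ x < m ] χ B x + 2 * ∑[ x < m ] χ D x)
      ≡ ℤ.+ (m + 4 * mult B D (j ⊖ₘ i))
  ·ᵀ-entry B D i j = begin
    M i j ℤ.+ ℤ.+ (2 * sum (χ B) + 2 * sum (χ D))
      ≡⟨ cong (λ s → M i j ℤ.+ ℤ.+ s) linear ⟩
    M i j ℤ.+ ℤ.+ sum (λ k → 2 * a k + 2 * b k)
      ≡⟨ Σℤ-+-∑ m (λ k → (B ᶜ) i k ℤ.* (D ᶜ) j k) (λ k → 2 * a k + 2 * b k) (λ k → 1 + 4 * (a k * b k))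
                (λ k → ±1-product (a k) (b k)) ⟩
    ℤ.+ sum (λ k → 1 + 4 * (a k * b k))
      ≡⟨ cong ℤ.+_ quadratic ⟩
    ℤ.+ (m + 4 * mult B D (j ⊖ₘ i))
      ∎
    where
    open ≡-Reasoning
    M : Fin m → Fin m → ℤ
    M = (B ᶜ) ·ᵀ (D ᶜ)
    a b : Fin m → ℕ
    a k = χ B (k ⊖ₘ i)
    b k = χ D (k ⊖ₘ j)
    linear : 2 * sum (χ B) + 2 * sum (χ D) ≡ sum (λ k → 2 * a k + 2 * b k)
    linear = begin
      2 * sum (χ B) + 2 * sum (χ D)                ≡⟨ cong₂ (λ u v → 2 * u + 2 * v) (ℕ-sum-shift (χ B) i) (ℕ-sum-shift (χ D) j) ⟩
      2 * sum a + 2 * sum b                        ≡⟨ cong₂ _+_ (*-distribˡ-sum 2 a) (*-distribˡ-sum 2 b) ⟩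
      sum (λ k → 2 * a k) + sum (λ k → 2 * b k)    ≡⟨ ∑-distrib-+ (λ k → 2 * a k) (λ k → 2 * b k) ⟨
      sum (λ k → 2 * a k + 2 * b k)                ∎
    quadratic : sum (λ k → 1 + 4 * (a k * b k)) ≡ m + 4 * mult B D (j ⊖ₘ i)
    quadratic = begin
      sum (λ k → 1 + 4 * (a k * b k))                ≡⟨ ∑-distrib-+ {m} (λ _ → 1) (λ k → 4 * (a k * b k)) ⟩
      ∑[ k < m ] 1 + sum (λ k → 4 * (a k * b k))     ≡⟨ cong (_+ sum (λ k → 4 * (a k * b k))) (∑[i<k]1≡k m) ⟩
      m + sum (λ k → 4 * (a k * b k))                ≡⟨ cong (m +_) (*-distribˡ-sum 4 (λ k → a k * b k)) ⟨
      m + 4 * sum (λ k → a k * b k)                  ≡⟨ cong (λ s → m + 4 * s) (∑-shifted-product≡correlation B D i j) ⟩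
      m + 4 * correlation B D (j ⊖ₘ i)               ≡⟨ cong (λ s → m + 4 * s) (mult≡correlation B D (j ⊖ₘ i)) ⟨
      m + 4 * mult B D (j ⊖ₘ i)                      ∎

  ·ᵀ-symmetric⇔ : ∀ B D (i j : Fin m) →
    ((B ᶜ) ·ᵀ (D ᶜ)) i j ≡ ((B ᶜ) ·ᵀ (D ᶜ)) j i ⇔ mult B D (j ⊖ₘ i) ≡ mult B D (i ⊖ₘ j)
  ·ᵀ-symmetric⇔ B D i j = mk⇔ to from
    where
    open ≡-Reasoning
    M : Fin m → Fin m → ℤ
    M = (B ᶜ) ·ᵀ (D ᶜ)
    c : ℤ
    c = ℤ.+ (2 * ∑[ x < m ] χ B x + 2 * ∑[ x < m ] χ D x)
    to : M i j ≡ M j i → mult B D (j ⊖ₘ i) ≡ mult B D (i ⊖ₘ j)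
    to Mij≡Mji = ℕ.*-cancelˡ-≡ _ _ 4 (ℕ.+-cancelˡ-≡ m _ _ (ℤ.+-injective (begin
      ℤ.+ (m + 4 * mult B D (j ⊖ₘ i))   ≡⟨ ·ᵀ-entry B D i j ⟨
      M i j ℤ.+ c                       ≡⟨ cong (λ e → e ℤ.+ c) Mij≡Mji ⟩
      M j i ℤ.+ c                       ≡⟨ ·ᵀ-entry B D j i ⟩
      ℤ.+ (m + 4 * mult B D (i ⊖ₘ j))   ∎)))
    from : mult B D (j ⊖ₘ i) ≡ mult B D (i ⊖ₘ j) → M i j ≡ M j i
    from mult≡ = ∙-cancelʳ c (M i j) (M j i) (begin
      M i j ℤ.+ c                       ≡⟨ ·ᵀ-entry B D i j ⟩
      ℤ.+ (m + 4 * mult B D (j ⊖ₘ i))   ≡⟨ cong (λ e → ℤ.+ (m + 4 * e)) mult≡ ⟩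
      ℤ.+ (m + 4 * mult B D (i ⊖ₘ j))   ≡⟨ ·ᵀ-entry B D j i ⟨
      M j i ℤ.+ c                       ∎)

lemma5 : (m : ℕ) .{{_ : NonZero m}} (B D : Subset m) →
         Nonempty B → Nonempty D →
         (DiffSymmetric B D → Amicable (B ᶜ) (D ᶜ)) × (Amicable (B ᶜ) (D ᶜ) → DiffSymmetric B D)
lemma5 (suc n) B D _ _ = amicable , diffSymmetric
  where
  amicable : DiffSymmetric B D → Amicable (B ᶜ) (D ᶜ)
  amicable B-D-symmetric i j = Equivalence.from (·ᵀ-symmetric⇔ B D i j)
    (trans (B-D-symmetric (j ⊖ₘ i)) (cong (mult B D) (negₘ[j⊖i]≡i⊖j i j)))
  diffSymmetric : Amicable (B ᶜ) (D ᶜ) → DiffSymmetric B D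
  diffSymmetric BᶜDᶜ-amicable w = subst (λ v → mult B D v ≡ mult B D (negₘ w)) (x⊖0≡x w)
    (Equivalence.to (·ᵀ-symmetric⇔ B D zero w) (BᶜDᶜ-amicable zero w))
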